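{- Let $S$ be an integral monoid and let $\mu$ be the M\"obius function of $S$. Then $\mu(1)=1$ and, for $z\in S$ with $z\neq1$, setting $\mathcal F(z)=\{zp^{ -1}: p\in\mathrm{PD}_\ddagger(z)\}$ and $\mathcal F_\ddagger(z)=\{p^{ -1}z: p\in\mathrm{PD}(z)\}$, $$\mu(z)=\sum_{\emptyset\neq F\subseteq\mathcal F(z),\ \gcd(F)=1}(-1)^{|F|}=\sum_{\emptyset\neq F\subseteq\mathcal F_\ddagger(z),\ \gcd_\ddagger(z;F)=1}(-1)^{|F|}.$$
   Context: Integral monoid: $G$ countable group, $G\ne\{1\}$, $S\subseteq G$ submonoid with (I) $S\cap S^{ -1}=\{1\}$; (II) every $u\in G$ can be written $u=xy^{ -1}$ ($x,y\in S$) such that whenever $u=zw^{ -1}$ with $z,w\in S$ there is $c\in S$ with $z=xc,w=yc$; (III) each $u\in S$ has finitely many factorizations $u=vw$ in $S$. Write $u\mid w$ if $w\in uS$ and $v\ddagger w$ (co-divides) if $w\in Sv$. For $u_1,\dots,u_k\in S$, $\mathrm{lcm}[u_1,\dots,u_k]$ is the unique $w\in S$ with $u_1S\cap\cdots\cap u_kS=wS$, and $\gcd(u_1,\dots,u_k)=\mathrm{lcm}[w\in S: w\mid u_j\ \forall j]$. For $u_1,\dots,u_k\ddagger w$, $\gcd_\ddagger(w;u_1,\dots,u_k)=(\mathrm{lcm}[wu_1^{ -1},\dots,wu_k^{ -1}])^{ -1}w$. The divisor function is $\tau(z)=\#\{(z_1,z_2)\in S^2:z=z_1z_2\}$; $p$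 is irreducible if $\tau(p)=2$. $\mathrm{PD}(z)$ and $\mathrm{PD}_\ddagger(z)$ are the sets of irreducible divisors and irreducible co-divisors of $z$. The convolution of $f,g:S\to\mathbb C$ is $(f*g)(z)=\sum_{z_1z_2=z}f(z_1)g(z_2)$, and $\mu$ is the unique function with $\mu*1=1*\mu=\delta_1$, where $1$ is the constant function and $\delta_1$ the indicator of $\{1\}$. -}

module Defs where

open import Data.Nat using (ℕ)
open import Data.Integer as ℤ using (ℤ; -1ℤ; 0ℤ; 1ℤ)
open import Data.List using (List; map; length; lookup; foldr)
open import Data.List.Membership.Propositional using (_∈_)
open import Data.List.Relation.Unary.Unique.Propositional using (Unique)
open import Data.Fin.Subset as Sub using (Subset; Nonempty)
open import Data.Product using (Σ; ∃; ∃₂; _×_; _,_; proj₁; proj₂)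
open import Relation.Binary.PropositionalEquality using (_≡_; _≢_)
open import Algebra.Structures using (IsGroup)
open import Function using (_∘_)
open import Function.Definitions using (Injective)
open import Function.Bundles using (_⇔_)

record IntegralMonoid : Set₁ where
  infixl 7 _∙_
  field
    G        : Set
    _∙_      : G → G → G
    ε        : G
    _⁻¹      : G → G
    isGroup  : IsGroup _≡_ _∙_ ε _⁻¹
    countable : ∃ λ (f : G → ℕ) → Injective _≡_ _≡_ f
    nontrivial : ∃ λ g → g ≢ ε
    S        : G → Set
    S-ε      : S ε
    S-∙      : ∀ {x y} → S x → S y → S (x ∙ y)
    axI      : ∀ {x} → S x → S (x ⁻¹) → x ≡ ε
    -- (II) every u has a "reduced" representation u = x y⁻¹
    axII     : ∀ u → ∃₂ λ x y → S x × S y × u ≡ x ∙ (y ⁻¹) ×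
                 (∀ z w → S z → S w → u ≡ z ∙ (w ⁻¹) →
                    ∃ λ c → S c × z ≡ x ∙ c × w ≡ y ∙ c)
    axIII    : ∀ u → S u → ∃ λ (L : List (G × G)) →
                 ∀ v w → S v → S w → v ∙ w ≡ u → (v , w) ∈ L

Enumerates : {A : Set} → (A → Set) → List A → Set
Enumerates P L = Unique L × (∀ x → (x ∈ L) ⇔ P x)

sumℤ : List ℤ → ℤ
sumℤ = foldr ℤ._+_ 0ℤ

sign : ∀ {n} → Subset n → ℤ
sign F = -1ℤ ℤ.^ Sub.∣ F ∣

-- "Σ_{F : P F} (-1)^{|F|} = s", for P a predicate on subsets of a finite
-- set of size n: the sum over any (duplicate-free, exact) enumeration of P.
SignedSubsetSum : (n : ℕ) → (Subset n → Set) → ℤ → Set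
SignedSubsetSum n P s = ∀ (Fs : List (Subset n)) → Enumerates P Fs → s ≡ sumℤ (map sign Fs)

module IM (M : IntegralMonoid) where
  open IntegralMonoid M

  _∣_ : G → G → Set
  u ∣ w = ∃ λ s → S s × w ≡ u ∙ s

  _‡_ : G → G → Set
  v ‡ w = ∃ λ s → S s × w ≡ s ∙ v

  Factorization : G → G × G → Set
  Factorization z (a , b) = S a × S b × a ∙ b ≡ z

  Tau : G → ℕ → Set
  Tau z n = ∃ λ (L : List (G × G)) → Enumerates (Factorization z) L × length L ≡ n

  Irreducible : G → Set
  Irreducible p = S p × Tau p 2

  PD : G → G → Set
  PD z p = Irreducible p × p ∣ z

  PD‡ : G → G → Set
  PD‡ z p = Irreducible p × p ‡ z

  𝓕 : G → G → Set
  𝓕 z x = ∃ λ p → PD‡ z p × x ≡ z ∙ (p ⁻¹)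

  𝓕‡ : G → G → Set
  𝓕‡ z x = ∃ λ p → PD z p × x ≡ (p ⁻¹) ∙ z

  IsLcm : (G → Set) → G → Set
  IsLcm P w = S w × (∀ x → (∀ v → P v → v ∣ x) ⇔ (w ∣ x))

  CommonDiv : (G → Set) → G → Set
  CommonDiv P w = S w × (∀ u → P u → w ∣ u)

  IsGcd : (G → Set) → G → Set
  IsGcd P g = IsLcm (CommonDiv P) g

  IsGcd‡ : G → (G → Set) → G → Set
  IsGcd‡ z P g = ∃ λ l → IsLcm (λ v → ∃ λ u → P u × v ≡ z ∙ (u ⁻¹)) l × g ≡ (l ⁻¹) ∙ z

  Elem : (L : List G) → Subset (length L) → G → Set
  Elem L F x = ∃ λ i → i Sub.∈ F × lookup L i ≡ x

  IsDelta : G → ℤ → Set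
  IsDelta z n = (z ≡ ε → n ≡ 1ℤ) × (z ≢ ε → n ≡ 0ℤ)

  -- μ * 1 = 1 * μ = δ₁ on S (values of μ off S are irrelevant)
  IsMobius : (G → ℤ) → Set
  IsMobius μ = ∀ z → S z → ∀ (L : List (G × G)) → Enumerates (Factorization z) L →
                 IsDelta z (sumℤ (map (μ ∘ proj₁) L)) × IsDelta z (sumℤ (map (μ ∘ proj₂) L))

{-# OPTIONS --safe #-}

-- Every proper divisor of z ≠ 1 divides one of the maximal proper divisors z p⁻¹ ∈ 𝓕(z),
-- so the only factorization z = de whose d divides no element of 𝓕(z) is (z , 1), and
-- μ(z) = Σ_{de=z} μ(d) [d divides no element of 𝓕(z)]. Inclusion–exclusion
-- turns this into Σ_F (-1)^|F| Σ_{de=z, d | every element of F} μ(d). For F ≠ ∅ the common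
-- divisors of F are the divisors of gcd(F), so the inner sum is Σ_{de=gcd F} μ(d) = [gcd F = 1];
-- for F = ∅ it is Σ_{de=z} μ(d) = 0. The second formula is the mirror image using 1 * μ = δ₁,
-- whose inner sums run over the co-divisors of gcd‡(z;F) = (lcm[z u⁻¹ : u ∈ F])⁻¹ z.

module Submission where

open import Defs
open import Data.Integer using (ℤ; 1ℤ)
open import Data.List using (List; length)
open import Data.Fin.Subset using (Nonempty)
open import Data.Product using (_×_)
open import Relation.Binary.PropositionalEquality using (_≡_; _≢_)

open import Algebra.Bundles using (Group)
open import Algebra.Structures using (IsGroup)
import Algebra.Properties.Group as GroupProperties
open import Data.Bool using (true; false; if_then_else_)
open import Data.Fin using (Fin; zero; suc)
open import Data.Fin.Subset using (Subset; inside; outside; _⊆_; Empty)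
import Data.Fin.Subset as Sub
open import Data.Fin.Subset.Properties using (_⊆?_; _∈?_; nonempty?; drop-∷-Empty)
open import Data.Integer using (0ℤ; -1ℤ; _+_; _*_)
import Data.Integer.Properties as ℤ
open import Algebra.Properties.CommutativeSemigroup ℤ.+-commutativeSemigroup
  using () renaming (interchange to +-interchange)
open import Data.List using ([]; _∷_; _++_; map; filter; deduplicate; allFin; lookup)
open import Data.List.Properties using (map-cong; map-∘)
open import Data.List.Membership.Propositional using (_∈_)
open import Data.List.Membership.Propositional.Properties
  using (∈-filter⁺; ∈-filter⁻; ∈-map⁺; ∈-map⁻; ∈-lookup; ∈-++⁺ˡ; ∈-++⁺ʳ; ∈-deduplicate⁺; ∈-deduplicate⁻; ∈-allFin)
open import Data.List.Membership.Propositional.Properties.WithK using (unique∧set⇒bag)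
open import Data.List.Relation.Binary.BagAndSetEquality using (∼bag⇒↭)
open import Data.List.Relation.Binary.Permutation.Propositional using (_↭_; ↭⇒↭ₛ)
import Data.List.Relation.Binary.Permutation.Propositional.Properties as ↭
import Data.List.Relation.Binary.Permutation.Setoid.Properties as ↭ₛ
open import Data.List.Relation.Unary.All as All using (All; all?; []; _∷_)
open import Data.List.Relation.Unary.AllPairs using ([]; _∷_)
open import Data.List.Relation.Unary.Any using (here; there; index)
open import Data.List.Relation.Unary.Any.Properties using (lookup-index)
open import Data.List.Relation.Unary.Unique.Propositional using (Unique)
import Data.List.Relation.Unary.Unique.Propositional.Properties as Unique
import Data.List.Relation.Unary.Unique.DecPropositional.Properties as DecUnique
open import Data.Nat using (ℕ; zero; suc)
import Data.Nat.Properties as ℕ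
open import Data.Product using (∃; _,_; proj₁; proj₂; map₁; map₂)
open import Data.Product.Function.NonDependent.Propositional using (_×-⇔_)
open import Data.Product.Properties using (×-≡,≡→≡)
import Data.Product.Properties as Product
open import Data.Sum using (_⊎_; inj₁; inj₂)
open import Data.Unit using (⊤; tt)
open import Data.Vec using (_∷_; []; here; there; tabulate)
open import Data.Vec.Properties using (∷-injectiveʳ)
open import Function using (_∘_; case_of_; _⇔_; mk⇔; Equivalence)
import Function.Properties.Equivalence as ⇔
open import Relation.Binary.Definitions using (DecidableEquality; Decidable; Transitive; Antisymmetric)
open import Relation.Binary.PropositionalEquality
  using (refl; sym; trans; cong; cong₂; subst; setoid; module ≡-Reasoning)
open import Relation.Nullary using (Dec; yes; no; ¬_; ¬?; _×-dec_; does; contradiction)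
import Relation.Nullary.Decidable as Dec

open Equivalence using (to; from)

private variable A B : Set

Σ[_] : List A → (A → ℤ) → ℤ
Σ[ xs ] f = sumℤ (map f xs)

Σ-0 : (xs : List A) → Σ[ xs ] (λ _ → 0ℤ) ≡ 0ℤ
Σ-0 []       = refl
Σ-0 (_ ∷ xs) = trans (ℤ.+-identityˡ _) (Σ-0 xs)

Σ-++ : (xs ys : List A) (f : A → ℤ) → Σ[ xs ++ ys ] f ≡ Σ[ xs ] f + Σ[ ys ] f
Σ-++ []       ys f = sym (ℤ.+-identityˡ _)
Σ-++ (x ∷ xs) ys f = trans (cong (f x +_) (Σ-++ xs ys f)) (sym (ℤ.+-assoc (f x) _ _))

Σ-cong : (xs : List A) {f g : A → ℤ} → (∀ x → f x ≡ g x) → Σ[ xs ] f ≡ Σ[ xs ] g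
Σ-cong xs f≗g = cong sumℤ (map-cong f≗g xs)

Σ-+ : (xs : List A) (f g : A → ℤ) → Σ[ xs ] (λ x → f x + g x) ≡ Σ[ xs ] f + Σ[ xs ] g
Σ-+ []       f g = refl
Σ-+ (x ∷ xs) f g =
  trans (cong (f x + g x +_) (Σ-+ xs f g)) (+-interchange (f x) (g x) (Σ[ xs ] f) (Σ[ xs ] g))

Σ-*ˡ : (xs : List A) (c : ℤ) (f : A → ℤ) → Σ[ xs ] (λ x → c * f x) ≡ c * Σ[ xs ] f
Σ-*ˡ []       c f = sym (ℤ.*-zeroʳ c)
Σ-*ˡ (x ∷ xs) c f = trans (cong (c * f x +_) (Σ-*ˡ xs c f)) (sym (ℤ.*-distribˡ-+ c (f x) _))

Σ-*ʳ : (xs : List A) (c : ℤ) (f : A → ℤ) → Σ[ xs ] (λ x → f x * c) ≡ Σ[ xs ] f * c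
Σ-*ʳ xs c f = trans (Σ-cong xs (λ x → ℤ.*-comm (f x) c)) (trans (Σ-*ˡ xs c f) (ℤ.*-comm c _))

Σ-swap : (xs : List A) (ys : List B) (h : A → B → ℤ) →
  Σ[ xs ] (λ x → Σ[ ys ] (h x)) ≡ Σ[ ys ] (λ y → Σ[ xs ] (λ x → h x y))
Σ-swap []       ys h = sym (Σ-0 ys)
Σ-swap (x ∷ xs) ys h =
  trans (cong (Σ[ ys ] (h x) +_) (Σ-swap xs ys h)) (sym (Σ-+ ys (h x) (λ y → Σ[ xs ] (λ x → h x y))))

Σ-map : (xs : List B) (g : B → A) (f : A → ℤ) → Σ[ map g xs ] f ≡ Σ[ xs ] (f ∘ g)
Σ-map xs g f = cong sumℤ (sym (map-∘ xs))

Σ-interchange : (xs : List A) (ys : List B) (a : B → ℤ) (b : A → B → ℤ) (c : A → ℤ) →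
  Σ[ xs ] (λ x → Σ[ ys ] (λ y → a y * b x y) * c x) ≡ Σ[ ys ] (λ y → a y * Σ[ xs ] (λ x → b x y * c x))
Σ-interchange xs ys a b c = begin
    Σ[ xs ] (λ x → Σ[ ys ] (λ y → a y * b x y) * c x)
  ≡⟨ Σ-cong xs (λ x → sym (Σ-*ʳ ys (c x) (λ y → a y * b x y))) ⟩
    Σ[ xs ] (λ x → Σ[ ys ] (λ y → a y * b x y * c x))
  ≡⟨ Σ-swap xs ys (λ x y → a y * b x y * c x) ⟩
    Σ[ ys ] (λ y → Σ[ xs ] (λ x → a y * b x y * c x))
  ≡⟨ Σ-cong ys (λ y → trans (Σ-cong xs (λ x → ℤ.*-assoc (a y) (b x y) (c x))) (Σ-*ˡ xs (a y) (λ x → b x y * c x))) ⟩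
    Σ[ ys ] (λ y → a y * Σ[ xs ] (λ x → b x y * c x)) ∎
  where open ≡-Reasoning

Σ-↭ : {xs ys : List A} (f : A → ℤ) → xs ↭ ys → Σ[ xs ] f ≡ Σ[ ys ] f
Σ-↭ f p = ↭ₛ.foldr-commMonoid (setoid ℤ) ℤ.+-0-isCommutativeMonoid (↭⇒↭ₛ (↭.map⁺ f p))

⟦_⟧ : {P : Set} → Dec P → ℤ
⟦ P? ⟧ = if does P? then 1ℤ else 0ℤ

module _ {P Q : Set} where

  ⟦⟧-cong : P ⇔ Q → (P? : Dec P) (Q? : Dec Q) → ⟦ P? ⟧ ≡ ⟦ Q? ⟧
  ⟦⟧-cong P⇔Q (yes _) (yes _) = refl
  ⟦⟧-cong P⇔Q (yes p) (no ¬q) = contradiction (to P⇔Q p) ¬q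
  ⟦⟧-cong P⇔Q (no ¬p) (yes q) = contradiction (from P⇔Q q) ¬p
  ⟦⟧-cong P⇔Q (no _)  (no _)  = refl

⟦⟧-yes : {P : Set} → P → (P? : Dec P) → ⟦ P? ⟧ ≡ 1ℤ
⟦⟧-yes p P? = ⟦⟧-cong (mk⇔ (λ _ → tt) (λ _ → p)) P? (yes tt)

⟦⟧-no : {P : Set} → ¬ P → (P? : Dec P) → ⟦ P? ⟧ ≡ 0ℤ
⟦⟧-no ¬p P? = ⟦⟧-cong (mk⇔ ¬p (λ ())) P? (no (λ ()))

module _ {P : A → Set} (P? : ∀ x → Dec (P x)) where

  Σ-filter : (xs : List A) (f : A → ℤ) → Σ[ xs ] (λ x → ⟦ P? x ⟧ * f x) ≡ Σ[ filter P? xs ] f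
  Σ-filter []       f = refl
  Σ-filter (x ∷ xs) f with does (P? x)
  ... | true  = cong₂ _+_ (ℤ.*-identityˡ (f x)) (Σ-filter xs f)
  ... | false = trans (cong (_+ Σ[ xs ] (λ x → ⟦ P? x ⟧ * f x)) (ℤ.*-zeroˡ (f x))) (trans (ℤ.+-identityˡ _) (Σ-filter xs f))

∈-map⇔ : {f : A → B} {xs : List A} {y : B} → y ∈ map f xs ⇔ ∃ λ x → x ∈ xs × y ≡ f x
∈-map⇔ {f = f} = mk⇔ (∈-map⁻ f) (λ (x , x∈ , y≡fx) → subst (_∈ map f _) (sym y≡fx) (∈-map⁺ f x∈))

Σ-enumerates : {P Q : A → Set} {xs ys : List A} → Enumerates P xs → Enumerates Q ys →
  (∀ x → P x ⇔ Q x) → (f : A → ℤ) → Σ[ xs ] f ≡ Σ[ ys ] f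
Σ-enumerates (xs! , ∈xs⇔) (ys! , ∈ys⇔) P⇔Q f =
  Σ-↭ f (∼bag⇒↭ (unique∧set⇒bag xs! ys! (λ {x} → ⇔.trans (∈xs⇔ x) (⇔.trans (P⇔Q x) (⇔.sym (∈ys⇔ x))))))

HasSum : (A → Set) → (A → ℤ) → ℤ → Set
HasSum P f s = ∀ xs → Enumerates P xs → Σ[ xs ] f ≡ s

enumerates-⇔ : {P Q : A → Set} {xs : List A} → (∀ x → P x ⇔ Q x) → Enumerates P xs → Enumerates Q xs
enumerates-⇔ P⇔Q (xs! , ∈xs⇔) = xs! , λ x → ⇔.trans (∈xs⇔ x) (P⇔Q x)

hasSum-⇔ : {P Q : A → Set} {f : A → ℤ} {s : ℤ} → (∀ x → P x ⇔ Q x) → HasSum Q f s → HasSum P f s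
hasSum-⇔ P⇔Q ΣQ xs xs-enum = ΣQ xs (enumerates-⇔ P⇔Q xs-enum)

hasSum-singleton : (a : A) (f : A → ℤ) → HasSum (_≡ a) f (f a)
hasSum-singleton a f xs xs-enum =
  trans (Σ-enumerates xs-enum [a]-enum (λ _ → ⇔.refl) f) (ℤ.+-identityʳ (f a))
  where
  [a]-enum : Enumerates (_≡ a) (a ∷ [])
  [a]-enum = ([] ∷ []) , λ x → mk⇔ (λ { (here x≡a) → x≡a }) here

filter-enumerates : {P Q : A → Set} (Q? : ∀ x → Dec (Q x)) {xs : List A} →
  Enumerates P xs → Enumerates (λ x → P x × Q x) (filter Q? xs)
filter-enumerates Q? {xs} (xs! , ∈xs⇔) = Unique.filter⁺ Q? xs! , λ x → mk⇔
  (λ x∈ → let (x∈xs , q) = ∈-filter⁻ Q? {xs = xs} x∈ in to (∈xs⇔ x) x∈xs , q)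
  (λ (p , q) → ∈-filter⁺ Q? (from (∈xs⇔ x) p) q)

enumerate : (_≟_ : DecidableEquality A) {P : A → Set} (P? : ∀ x → Dec (P x)) (xs : List A) →
  (∀ x → P x → x ∈ xs) → Enumerates P (deduplicate _≟_ (filter P? xs))
enumerate _≟_ P? xs P⊆xs = DecUnique.deduplicate-! _≟_ (filter P? xs) , λ x → mk⇔
  (λ x∈ → proj₂ (∈-filter⁻ P? {xs = xs} (∈-deduplicate⁻ _≟_ (filter P? xs) x∈)))
  (λ p → ∈-deduplicate⁺ _≟_ (∈-filter⁺ P? (P⊆xs x p) p))

map-enumerates : {P : A → Set} {Q : B → Set} {g : A → B} → (∀ {x y} → g x ≡ g y → x ≡ y) →
  (∀ y → Q y ⇔ ∃ λ x → P x × y ≡ g x) → {xs : List A} → Enumerates P xs → Enumerates Q (map g xs)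
map-enumerates g-inj Q⇔image (xs! , ∈xs⇔) = Unique.map⁺ g-inj xs! , λ y → ⇔.trans ∈-map⇔ (mk⇔
  (λ (x , x∈ , y≡gx) → from (Q⇔image y) (x , to (∈xs⇔ x) x∈ , y≡gx))
  (λ q → let (x , p , y≡gx) = to (Q⇔image y) q in x , from (∈xs⇔ x) p , y≡gx))

module _ {P : A → Set} {L : List A} (L-enum : Enumerates P L) where

  lookup-∈ : ∀ i → P (lookup L i)
  lookup-∈ i = to (proj₂ L-enum (lookup L i)) (∈-lookup i)

  ∃-lookup : ∀ {x} → P x → ∃ λ i → lookup L i ≡ x
  ∃-lookup {x} p = let x∈ = from (proj₂ L-enum x) p in index x∈ , sym (lookup-index x∈)

select : ∀ {n} → (Fin n → A) → Subset n → List A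
select c F = map c (filter (_∈? F) (allFin _))

∈-select : ∀ {n} {c : Fin n → A} {F : Subset n} {x : A} → x ∈ select c F ⇔ ∃ λ i → i Sub.∈ F × c i ≡ x
∈-select {c = c} {F} = ⇔.trans ∈-map⇔ (mk⇔
  (λ (i , i∈ , x≡ci) → i , proj₂ (∈-filter⁻ (_∈? F) {xs = allFin _} i∈) , sym x≡ci)
  (λ (i , i∈F , ci≡x) → i , ∈-filter⁺ (_∈? F) (∈-allFin i) i∈F , sym ci≡x))

module _ {_≼_ : A → A → Set} (_≟_ : DecidableEquality A) (_≼?_ : Decidable _≼_)
         (≼-trans : Transitive _≼_) (≼-antisym : Antisymmetric _≡_ _≼_) where

  ∃-minimal : (x : A) (xs : List A) → ∃ λ m → m ∈ x ∷ xs × (∀ {y} → y ∈ x ∷ xs → y ≼ m → y ≡ m)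
  ∃-minimal x [] = x , here refl , λ { (here y≡x) _ → y≡x }
  ∃-minimal x (x′ ∷ xs) with ∃-minimal x′ xs
  ... | m , m∈ , m-min with x ≼? m | x ≟ m
  ... | yes x≼m | no x≢m = x , here refl , λ where
        (here y≡x) _    → y≡x
        (there y∈) y≼x → contradiction
          (≼-antisym x≼m (subst (_≼ x) (m-min y∈ (≼-trans y≼x x≼m)) y≼x)) x≢m
  ... | yes _ | yes x≡m = m , there m∈ , λ where
        (here refl) _ → x≡m
        (there y∈)    → m-min y∈
  ... | no x⋠m | _ = m , there m∈ , λ where
        (here refl) x≼m → contradiction x≼m x⋠m
        (there y∈)      → m-min y∈

subsets : ∀ n → List (Subset n)
subsets zero    = [] ∷ []
subsets (suc n) = map (outside ∷_) (subsets n) ++ map (inside ∷_) (subsets n)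

∈-subsets : ∀ {n} (F : Subset n) → F ∈ subsets n
∈-subsets []            = here refl
∈-subsets (outside ∷ F) = ∈-++⁺ˡ (∈-map⁺ (outside ∷_) (∈-subsets F))
∈-subsets (inside ∷ F)  = ∈-++⁺ʳ _ (∈-map⁺ (inside ∷_) (∈-subsets F))

subsets-enumerates : ∀ n → Enumerates (λ _ → ⊤) (subsets n)
subsets-enumerates n = subsets! n , λ F → mk⇔ (λ _ → tt) (λ _ → ∈-subsets F)
  where
  subsets! : ∀ n → Unique (subsets n)
  subsets! zero    = [] ∷ []
  subsets! (suc n) = Unique.++⁺ (Unique.map⁺ ∷-injectiveʳ (subsets! n)) (Unique.map⁺ ∷-injectiveʳ (subsets! n))
    λ (o∈ , i∈) → case (∈-map⁻ (outside ∷_) o∈ , ∈-map⁻ (inside ∷_) i∈) of λ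
      { ((_ , _ , refl) , (_ , _ , ())) }

Σ-subsets-suc : ∀ n (f : Subset (suc n) → ℤ) →
  Σ[ subsets (suc n) ] f ≡ Σ[ subsets n ] (f ∘ (outside ∷_)) + Σ[ subsets n ] (f ∘ (inside ∷_))
Σ-subsets-suc n f = trans (Σ-++ (map (outside ∷_) (subsets n)) _ f)
  (cong₂ _+_ (Σ-map (subsets n) (outside ∷_) f) (Σ-map (subsets n) (inside ∷_) f))

Σ-sign-⊆ : ∀ {n} (X : Subset n) (∅? : Dec (Empty X)) →
  Σ[ subsets n ] (λ F → sign F * ⟦ F ⊆? X ⟧) ≡ ⟦ ∅? ⟧
Σ-sign-⊆ [] ∅? = sym (⟦⟧-yes (λ ()) ∅?)
Σ-sign-⊆ {suc n} (outside ∷ X) ∅? = begin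
    Σ[ subsets (suc n) ] (λ F → sign F * ⟦ F ⊆? outside ∷ X ⟧)
  ≡⟨ Σ-subsets-suc n _ ⟩
    Σ[ subsets n ] (λ F → sign F * ⟦ F ⊆? X ⟧) + Σ[ subsets n ] (λ F → -1ℤ * sign F * 0ℤ)
  ≡⟨ cong₂ _+_ (Σ-sign-⊆ X ∅X?) (trans (Σ-cong (subsets n) (λ F → ℤ.*-zeroʳ (-1ℤ * sign F))) (Σ-0 (subsets n))) ⟩
    ⟦ ∅X? ⟧ + 0ℤ
  ≡⟨ trans (ℤ.+-identityʳ ⟦ ∅X? ⟧) (⟦⟧-cong (mk⇔ outside∷-Empty drop-∷-Empty) ∅X? ∅?) ⟩
    ⟦ ∅? ⟧ ∎
  where
  open ≡-Reasoning
  ∅X? = ¬? (nonempty? X)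
  outside∷-Empty : Empty X → Empty (outside ∷ X)
  outside∷-Empty ∅X (suc i , there i∈X) = ∅X (i , i∈X)
Σ-sign-⊆ {suc n} (inside ∷ X) ∅? = begin
    Σ[ subsets (suc n) ] (λ F → sign F * ⟦ F ⊆? inside ∷ X ⟧)
  ≡⟨ Σ-subsets-suc n _ ⟩
    s + Σ[ subsets n ] (λ F → -1ℤ * sign F * ⟦ F ⊆? X ⟧)
  ≡⟨ cong (s +_) (trans (Σ-cong (subsets n) (λ F → ℤ.*-assoc -1ℤ (sign F) _)) (Σ-*ˡ (subsets n) -1ℤ _)) ⟩
    s + -1ℤ * s
  ≡⟨ trans (cong (s +_) (ℤ.-1*i≡-i s)) (ℤ.+-inverseʳ s) ⟩
    0ℤ
  ≡⟨ sym (⟦⟧-no (λ ∅X → ∅X (zero , here)) ∅?) ⟩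
    ⟦ ∅? ⟧ ∎
  where
  open ≡-Reasoning
  s = Σ[ subsets n ] (λ F → sign F * ⟦ F ⊆? X ⟧)

⁅_⁆ : ∀ {n} {Q : Fin n → Set} → (∀ i → Dec (Q i)) → Subset n
⁅ Q? ⁆ = tabulate (does ∘ Q?)

∈⁅⁆ : ∀ {n} {Q : Fin n → Set} (Q? : ∀ i → Dec (Q i)) i → i Sub.∈ ⁅ Q? ⁆ ⇔ Q i
∈⁅⁆ Q? zero with Q? zero
... | yes q = mk⇔ (λ _ → q) (λ _ → here)
... | no ¬q = mk⇔ (λ ()) (λ q → contradiction q ¬q)
∈⁅⁆ Q? (suc i) = ⇔.trans (mk⇔ (λ { (there i∈) → i∈ }) there) (∈⁅⁆ (Q? ∘ suc) i)

AllIn : ∀ {n} → (Fin n → Set) → Subset n → Set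
AllIn Q F = ∀ i → i Sub.∈ F → Q i

module _ {n : ℕ} {Q : Fin n → Set} (Q? : ∀ i → Dec (Q i)) where

  ⊆⁅⁆⇔AllIn : (F : Subset n) → F ⊆ ⁅ Q? ⁆ ⇔ AllIn Q F
  ⊆⁅⁆⇔AllIn F = mk⇔ (λ F⊆ i i∈F → to (∈⁅⁆ Q? i) (F⊆ i∈F)) (λ all {i} i∈F → from (∈⁅⁆ Q? i) (all i i∈F))

  Empty⁅⁆⇔ : Empty ⁅ Q? ⁆ ⇔ (∀ i → ¬ Q i)
  Empty⁅⁆⇔ = mk⇔ (λ ∅ i q → ∅ (i , from (∈⁅⁆ Q? i) q)) (λ none (i , i∈) → none i (to (∈⁅⁆ Q? i) i∈))

-- Inclusion–exclusion: [∀ i → ¬ R x i] = Σ_F (-1)^|F| [∀ i ∈ F → R x i], summed against φ over D.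
module _ {A : Set} {n : ℕ} (R : A → Fin n → Set) (R? : ∀ x i → Dec (R x i)) where

  sieve : {D : A → Set} {xs : List A} → Enumerates D xs → (φ : A → ℤ) {s : ℤ} →
    HasSum (λ x → D x × (∀ i → ¬ R x i)) φ s →
    {P : Subset n → Set} (P? : ∀ F → Dec (P F)) →
    (∀ F → HasSum (λ x → D x × AllIn (R x) F) φ ⟦ P? F ⟧) →
    SignedSubsetSum n P s
  sieve {D} {xs} xs-enum φ {s} Σ-none P? Σ-below Fs Fs-enum = begin
      s
    ≡⟨ sym (Σ-none _ (enumerates-⇔ (λ x → ⇔.refl ×-⇔ Empty⁅⁆⇔ (R? x)) (filter-enumerates ∅? xs-enum))) ⟩
      Σ[ filter ∅? xs ] φ
    ≡⟨ sym (Σ-filter ∅? xs φ) ⟩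
      Σ[ xs ] (λ x → ⟦ ∅? x ⟧ * φ x)
    ≡⟨ Σ-cong xs (λ x → cong (_* φ x) (sym (Σ-sign-⊆ (σ x) (∅? x)))) ⟩
      Σ[ xs ] (λ x → Σ[ subsets n ] (λ F → sign F * ⟦ F ⊆? σ x ⟧) * φ x)
    ≡⟨ Σ-interchange xs (subsets n) sign (λ x F → ⟦ F ⊆? σ x ⟧) φ ⟩
      Σ[ subsets n ] (λ F → sign F * Σ[ xs ] (λ x → ⟦ F ⊆? σ x ⟧ * φ x))
    ≡⟨ Σ-cong (subsets n) (λ F → cong (sign F *_) (trans (Σ-filter (λ x → F ⊆? σ x) xs φ) (Σ-below F _ (below F)))) ⟩
      Σ[ subsets n ] (λ F → sign F * ⟦ P? F ⟧)
    ≡⟨ Σ-cong (subsets n) (λ F → ℤ.*-comm (sign F) _) ⟩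
      Σ[ subsets n ] (λ F → ⟦ P? F ⟧ * sign F)
    ≡⟨ Σ-filter P? (subsets n) sign ⟩
      Σ[ filter P? (subsets n) ] sign
    ≡⟨ Σ-enumerates (filter-enumerates P? (subsets-enumerates n)) Fs-enum (λ F → mk⇔ proj₂ (tt ,_)) sign ⟩
      Σ[ Fs ] sign ∎
    where
    open ≡-Reasoning
    σ : A → Subset n
    σ x = ⁅ R? x ⁆
    ∅? : ∀ x → Dec (Empty (σ x))
    ∅? x = ¬? (nonempty? (σ x))
    below : ∀ F → Enumerates (λ x → D x × AllIn (R x) F) (filter (λ x → F ⊆? σ x) xs)
    below F = enumerates-⇔ (λ x → ⇔.refl ×-⇔ ⊆⁅⁆⇔AllIn (R? x) F) (filter-enumerates (λ x → F ⊆? σ x) xs-enum)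

module Theory (M : IntegralMonoid) where
  open IntegralMonoid M
  open IM M
  open IsGroup isGroup using (assoc; identityˡ; identityʳ)

  private
    group : Group _ _
    group = record { isGroup = isGroup }

  open GroupProperties group
    using (\\-leftDividesˡ; \\-leftDividesʳ; //-rightDividesˡ; y≈x\\z; x≈z//y; inverseˡ-unique; inverseʳ-unique;
           ε⁻¹≈ε; ∙-cancelˡ; ∙-cancelʳ; ⁻¹-anti-homo-∙; ⁻¹-involutive)

  infix 4 _≟_
  _≟_ : DecidableEquality G
  x ≟ y = Dec.map′ (proj₂ countable) (cong (proj₁ countable)) (proj₁ countable x ℕ.≟ proj₁ countable y)

  x∙y≡ε⇒x≡ε : ∀ {x y} → S x → S y → x ∙ y ≡ ε → x ≡ ε
  x∙y≡ε⇒x≡ε {x} {y} sx sy xy≡ε = axI sx (subst S (inverseʳ-unique x y xy≡ε) sy)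

  x∙y≡ε⇒y≡ε : ∀ {x y} → S x → S y → x ∙ y ≡ ε → y ≡ ε
  x∙y≡ε⇒y≡ε {x} {y} sx sy xy≡ε = axI sy (subst S (inverseˡ-unique x y xy≡ε) sx)

  -- u ∈ S exactly when the denominator of its reduced fraction in (II) is 1.
  S? : ∀ u → Dec (S u)
  S? u with axII u
  ... | x , y , sx , sy , u≡xy⁻¹ , reduced with y ≟ ε
  ... | yes refl = yes (subst S (sym (trans u≡xy⁻¹ (trans (cong (x ∙_) ε⁻¹≈ε) (identityʳ x)))) sx)
  ... | no y≢ε = no λ su →
    let (c , sc , _ , ε≡yc) = reduced u ε su S-ε (sym (trans (cong (u ∙_) ε⁻¹≈ε) (identityʳ u)))
    in y≢ε (x∙y≡ε⇒x≡ε sy sc (sym ε≡yc))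

  ∣⇔S : ∀ {u w} → u ∣ w ⇔ S (u ⁻¹ ∙ w)
  ∣⇔S {u} {w} = mk⇔ (λ (s , ss , w≡us) → subst S (y≈x\\z u s w (sym w≡us)) ss)
                     (λ s → u ⁻¹ ∙ w , s , sym (\\-leftDividesˡ u w))

  ‡⇔S : ∀ {v w} → v ‡ w ⇔ S (w ∙ v ⁻¹)
  ‡⇔S {v} {w} = mk⇔ (λ (s , ss , w≡sv) → subst S (x≈z//y s v w (sym w≡sv)) ss)
                     (λ s → w ∙ v ⁻¹ , s , sym (//-rightDividesˡ v w))

  _∣?_ : ∀ u w → Dec (u ∣ w)
  u ∣? w = Dec.map (⇔.sym ∣⇔S) (S? (u ⁻¹ ∙ w))

  _‡?_ : ∀ v w → Dec (v ‡ w)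
  v ‡? w = Dec.map (⇔.sym ‡⇔S) (S? (w ∙ v ⁻¹))

  ∣-refl : ∀ u → u ∣ u
  ∣-refl u = ε , S-ε , sym (identityʳ u)

  ‡-refl : ∀ u → u ‡ u
  ‡-refl u = ε , S-ε , sym (identityˡ u)

  ∣-trans : ∀ {a b c} → a ∣ b → b ∣ c → a ∣ c
  ∣-trans {a} (s , ss , refl) (t , st , refl) = s ∙ t , S-∙ ss st , assoc a s t

  ‡-trans : ∀ {a b c} → a ‡ b → b ‡ c → a ‡ c
  ‡-trans {a} (s , ss , refl) (t , st , refl) = t ∙ s , S-∙ st ss , sym (assoc t s a)

  ∣-antisym : ∀ {a b} → a ∣ b → b ∣ a → a ≡ b
  ∣-antisym {a} (s , ss , refl) (t , st , a≡a∙s∙t) = trans (sym (identityʳ a)) (cong (a ∙_) (sym s≡ε))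
    where
    s≡ε = x∙y≡ε⇒x≡ε ss st (∙-cancelˡ a (s ∙ t) ε (trans (sym (assoc a s t)) (trans (sym a≡a∙s∙t) (sym (identityʳ a)))))

  ‡-antisym : ∀ {a b} → a ‡ b → b ‡ a → a ≡ b
  ‡-antisym {a} (s , ss , refl) (t , st , a≡t∙s∙a) = trans (sym (identityˡ a)) (cong (_∙ a) (sym s≡ε))
    where
    s≡ε = x∙y≡ε⇒y≡ε st ss (∙-cancelʳ a (t ∙ s) ε (trans (assoc t s a) (trans (sym a≡t∙s∙a) (sym (identityˡ a)))))

  ∣⇒S : ∀ {u w} → S u → u ∣ w → S w
  ∣⇒S su (s , ss , refl) = S-∙ su ss

  ‡⇒S : ∀ {v w} → S v → v ‡ w → S w
  ‡⇒S sv (s , ss , refl) = S-∙ ss sv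

  ε∣ : ∀ {w} → S w → ε ∣ w
  ε∣ {w} sw = w , sw , sym (identityˡ w)

  ε‡ : ∀ {w} → S w → ε ‡ w
  ε‡ {w} sw = w , sw , sym (identityʳ w)

  factorization? : ∀ z x → Dec (Factorization z x)
  factorization? z (a , b) = S? a ×-dec (S? b ×-dec (a ∙ b ≟ z))

  factorizations : ∀ z → S z → List (G × G)
  factorizations z sz = deduplicate (Product.≡-dec _≟_ _≟_) (filter (factorization? z) (proj₁ (axIII z sz)))

  factorizations-enumerates : ∀ z (sz : S z) → Enumerates (Factorization z) (factorizations z sz)
  factorizations-enumerates z sz = enumerate (Product.≡-dec _≟_ _≟_) (factorization? z) (proj₁ (axIII z sz))
    (λ (a , b) (sa , sb , ab≡z) → proj₂ (axIII z sz) a b sa sb ab≡z)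

  leftFactors rightFactors : ∀ u → S u → List G
  leftFactors u su = map proj₁ (factorizations u su)
  rightFactors u su = map proj₂ (factorizations u su)

  ∈-leftFactors : ∀ {u a} (su : S u) → a ∈ leftFactors u su ⇔ (S a × a ∣ u)
  ∈-leftFactors {u} {a} su = ⇔.trans ∈-map⇔ (mk⇔
    (λ { ((a , b) , x∈ , refl) → let (sa , sb , ab≡u) = to (proj₂ (factorizations-enumerates u su) _) x∈ in sa , b , sb , sym ab≡u })
    (λ (sa , s , ss , u≡as) → (a , s) , from (proj₂ (factorizations-enumerates u su) _) (sa , ss , sym u≡as) , refl))

  ∈-rightFactors : ∀ {u b} (su : S u) → b ∈ rightFactors u su ⇔ (S b × b ‡ u)
  ∈-rightFactors {u} {b} su = ⇔.trans ∈-map⇔ (mk⇔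
    (λ { ((a , b) , x∈ , refl) → let (sa , sb , ab≡u) = to (proj₂ (factorizations-enumerates u su) _) x∈ in sb , a , sa , sym ab≡u })
    (λ (sb , s , ss , u≡sb) → (s , b) , from (proj₂ (factorizations-enumerates u su) _) (ss , sb , sym u≡sb) , refl))

  -- By (II), u⁻¹v = x y⁻¹ in lowest terms, and then ux = vy generates uS ∩ vS.
  lcm : G → G → G
  lcm u v = u ∙ proj₁ (axII (u ⁻¹ ∙ v))

  lcm-S : ∀ {u} v → S u → S (lcm u v)
  lcm-S {u} v su with axII (u ⁻¹ ∙ v)
  ... | x , _ , sx , _ = S-∙ su sx

  ∣-lcmˡ : ∀ u v → u ∣ lcm u v
  ∣-lcmˡ u v with axII (u ⁻¹ ∙ v)
  ... | x , _ , sx , _ = x , sx , refl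

  ∣-lcmʳ : ∀ u v → v ∣ lcm u v
  ∣-lcmʳ u v with axII (u ⁻¹ ∙ v)
  ... | x , y , sx , sy , u⁻¹v≡xy⁻¹ , _ = y , sy , sym (begin
      v ∙ y                 ≡⟨ cong (_∙ y) (sym (\\-leftDividesˡ u v)) ⟩
      (u ∙ (u ⁻¹ ∙ v)) ∙ y  ≡⟨ cong (λ t → (u ∙ t) ∙ y) u⁻¹v≡xy⁻¹ ⟩
      (u ∙ (x ∙ y ⁻¹)) ∙ y  ≡⟨ assoc u _ y ⟩
      u ∙ ((x ∙ y ⁻¹) ∙ y)  ≡⟨ cong (u ∙_) (//-rightDividesˡ y x) ⟩
      u ∙ x                 ∎)
    where open ≡-Reasoning

  lcm-least : ∀ {u v w} → u ∣ w → v ∣ w → lcm u v ∣ w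
  lcm-least {u} {v} {w} (a , sa , w≡ua) (b , sb , w≡vb) with axII (u ⁻¹ ∙ v)
  ... | x , y , _ , _ , _ , reduced =
    let u⁻¹v≡ab⁻¹ = trans (cong (u ⁻¹ ∙_) (x≈z//y v b w (sym w≡vb)))
                          (trans (sym (assoc _ _ _)) (cong (_∙ b ⁻¹) (sym (y≈x\\z u a w (sym w≡ua)))))
        (c , sc , a≡xc , _) = reduced a b sa sb u⁻¹v≡ab⁻¹
    in c , sc , trans w≡ua (trans (cong (u ∙_) a≡xc) (sym (assoc u x c)))

  lcmList : List G → G
  lcmList []       = ε
  lcmList (v ∷ vs) = lcm v (lcmList vs)

  module _ {P : G → Set} where

    IsLcm-⇔ : ∀ {Q w} → (∀ v → P v ⇔ Q v) → IsLcm P w → IsLcm Q w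
    IsLcm-⇔ P⇔Q (sw , least) = sw , λ x → ⇔.trans
      (mk⇔ (λ Q∣x v pv → Q∣x v (to (P⇔Q v) pv)) (λ P∣x v qv → P∣x v (from (P⇔Q v) qv))) (least x)

    IsLcm⇒∣ : ∀ {w v} → IsLcm P w → P v → v ∣ w
    IsLcm⇒∣ {w} (_ , least) pv = from (least w) (∣-refl w) _ pv

    IsLcm⇒least : ∀ {w x} → IsLcm P w → (∀ v → P v → v ∣ x) → w ∣ x
    IsLcm⇒least {x = x} (_ , least) = to (least x)

    IsLcm⇔≡ : ∀ {w w′} → IsLcm P w → IsLcm P w′ ⇔ w ≡ w′
    IsLcm⇔≡ w-lcm = mk⇔
      (λ w′-lcm → ∣-antisym (IsLcm⇒least w-lcm (λ _ → IsLcm⇒∣ w′-lcm)) (IsLcm⇒least w′-lcm (λ _ → IsLcm⇒∣ w-lcm)))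
      (λ w≡w′ → subst (IsLcm P) w≡w′ w-lcm)

  -- The member v₀ is needed: IsLcm quantifies over all x ∈ G, and ε ∣ x fails for x ∉ S.
  lcmList-isLcm : ∀ {v₀} vs → v₀ ∈ vs → (∀ v → v ∈ vs → S v) → IsLcm (_∈ vs) (lcmList vs)
  lcmList-isLcm {v₀} vs v₀∈ vs⊆S = lcmList-S vs vs⊆S , λ x → mk⇔
    (λ vs∣x → lcmList-least vs (∣⇒S (vs⊆S v₀ v₀∈) (vs∣x v₀ v₀∈)) vs∣x)
    (λ l∣x v v∈ → ∣-trans (∣-lcmList vs v∈) l∣x)
    where
    lcmList-S : ∀ vs → (∀ v → v ∈ vs → S v) → S (lcmList vs)
    lcmList-S []       _    = S-ε
    lcmList-S (v ∷ vs) vs⊆S = lcm-S (lcmList vs) (vs⊆S v (here refl))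
    ∣-lcmList : ∀ vs {v} → v ∈ vs → v ∣ lcmList vs
    ∣-lcmList (u ∷ vs) (here refl) = ∣-lcmˡ u (lcmList vs)
    ∣-lcmList (u ∷ vs) (there v∈)  = ∣-trans (∣-lcmList vs v∈) (∣-lcmʳ u (lcmList vs))
    lcmList-least : ∀ vs {x} → S x → (∀ v → v ∈ vs → v ∣ x) → lcmList vs ∣ x
    lcmList-least []       sx _    = ε∣ sx
    lcmList-least (v ∷ vs) sx vs∣x = lcm-least (vs∣x v (here refl)) (lcmList-least vs sx (λ u u∈ → vs∣x u (there u∈)))

  IsGcd-⇔ : ∀ {P Q g} → (∀ v → P v ⇔ Q v) → IsGcd P g → IsGcd Q g
  IsGcd-⇔ P⇔Q = IsLcm-⇔ λ w → mk⇔ (map₂ (λ P∣ u qu → P∣ u (from (P⇔Q u) qu))) (map₂ (λ Q∣ u pu → Q∣ u (to (P⇔Q u) pu)))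

  IsGcd⇒∣⇔ : ∀ {P g d} → IsGcd P g → S d → d ∣ g ⇔ (∀ u → P u → d ∣ u)
  IsGcd⇒∣⇔ {P} g-gcd sd = mk⇔
    (λ d∣g u pu → ∣-trans d∣g (IsLcm⇒least g-gcd (λ _ (_ , w∣P) → w∣P u pu)))
    (λ d∣P → IsLcm⇒∣ g-gcd (sd , d∣P))

  -- The common divisors of a family containing u are among the finitely many left factors of u.
  ∃-gcd : ∀ {u} vs → u ∈ vs → (∀ v → v ∈ vs → S v) → ∃ (IsGcd (_∈ vs))
  ∃-gcd {u} vs u∈ vs⊆S = lcmList cds , IsLcm-⇔ ∈cds⇔ (lcmList-isLcm cds ε∈cds (λ d d∈ → proj₁ (to (∈cds⇔ d) d∈)))
    where
    su = vs⊆S u u∈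
    cds = filter (λ d → all? (d ∣?_) vs) (leftFactors u su)
    ∈cds⇔ : ∀ d → d ∈ cds ⇔ (S d × ∀ v → v ∈ vs → d ∣ v)
    ∈cds⇔ d = mk⇔
      (λ d∈ → let (d∈lf , d∣vs) = ∈-filter⁻ (λ d → all? (d ∣?_) vs) {xs = leftFactors u su} d∈
              in proj₁ (to (∈-leftFactors su) d∈lf) , λ v v∈ → All.lookup d∣vs v∈)
      (λ (sd , d∣vs) → ∈-filter⁺ (λ d → all? (d ∣?_) vs) (from (∈-leftFactors su) (sd , d∣vs u u∈)) (All.tabulate (d∣vs _)))
    ε∈cds : ε ∈ cds
    ε∈cds = from (∈cds⇔ ε) (S-ε , λ v v∈ → ε∣ (vs⊆S v v∈))

  ε-factorization : ∀ {x} → Factorization ε x → x ≡ (ε , ε)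
  ε-factorization (sa , sb , ab≡ε) = ×-≡,≡→≡ (x∙y≡ε⇒x≡ε sa sb ab≡ε , x∙y≡ε⇒y≡ε sa sb ab≡ε)

  irreducible⇒≢ε : ∀ {p} → Irreducible p → p ≢ ε
  irreducible⇒≢ε (_ , (x ∷ y ∷ [] , (((x≢y ∷ []) ∷ _) , x∷y⇔) , refl)) refl =
    x≢y (trans (ε-factorization (to (x∷y⇔ x) (here refl))) (sym (ε-factorization (to (x∷y⇔ y) (there (here refl))))))

  irreducible-intro : ∀ {m} → S m → m ≢ ε →
    (∀ {a b} → Factorization m (a , b) → a ≡ ε ⊎ b ≡ ε) → Irreducible m
  irreducible-intro {m} sm m≢ε trivial = sm , ((ε , m) ∷ (m , ε) ∷ []) , (unique , ∈⇔) , refl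
    where
    unique : Unique ((ε , m) ∷ (m , ε) ∷ [])
    unique = ((λ εm≡mε → m≢ε (sym (cong proj₁ εm≡mε))) ∷ []) ∷ [] ∷ []
    ∈⇔ : ∀ x → x ∈ (ε , m) ∷ (m , ε) ∷ [] ⇔ Factorization m x
    ∈⇔ (a , b) = mk⇔
      (λ { (here refl) → S-ε , sm , identityˡ m ; (there (here refl)) → sm , S-ε , identityʳ m })
      (λ fact@(_ , _ , ab≡m) → case trivial fact of λ where
        (inj₁ refl) → here (cong (ε ,_) (trans (sym (identityˡ b)) ab≡m))
        (inj₂ refl) → there (here (cong (_, ε) (trans (sym (identityʳ a)) ab≡m))))

  ∣-minimal⇒irreducible : ∀ {m} → S m → m ≢ ε → (∀ {a} → S a → a ≢ ε → a ∣ m → a ≡ m) → Irreducible m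
  ∣-minimal⇒irreducible {m} sm m≢ε minimal = irreducible-intro sm m≢ε λ {a} {b} (sa , sb , ab≡m) →
    case a ≟ ε of λ where
      (yes a≡ε) → inj₁ a≡ε
      (no a≢ε)  → inj₂ (∙-cancelˡ a b ε (trans ab≡m (trans (sym (minimal sa a≢ε (b , sb , sym ab≡m))) (sym (identityʳ a)))))

  ‡-minimal⇒irreducible : ∀ {m} → S m → m ≢ ε → (∀ {b} → S b → b ≢ ε → b ‡ m → b ≡ m) → Irreducible m
  ‡-minimal⇒irreducible {m} sm m≢ε minimal = irreducible-intro sm m≢ε λ {a} {b} (sa , sb , ab≡m) →
    case b ≟ ε of λ where
      (yes b≡ε) → inj₂ b≡ε
      (no b≢ε)  → inj₁ (∙-cancelʳ b a ε (trans ab≡m (trans (sym (minimal sb b≢ε (a , sa , sym ab≡m))) (sym (identityˡ b)))))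

  ∃-irreducible-∣ : ∀ {s} → S s → s ≢ ε → ∃ λ p → Irreducible p × p ∣ s
  ∃-irreducible-∣ {s} ss s≢ε =
    let (m , m∈ , m-min) = ∃-minimal _≟_ _∣?_ ∣-trans ∣-antisym s candidates
        (sm , m∣s , m≢ε) = to candidate⇔ m∈
    in m , ∣-minimal⇒irreducible sm m≢ε (λ sa a≢ε a∣m → m-min (from candidate⇔ (sa , ∣-trans a∣m m∣s , a≢ε)) a∣m) , m∣s
    where
    candidates = filter (λ a → ¬? (a ≟ ε)) (leftFactors s ss)
    candidate⇔ : ∀ {a} → a ∈ s ∷ candidates ⇔ (S a × a ∣ s × a ≢ ε)
    candidate⇔ = mk⇔
      (λ { (here refl) → ss , ∣-refl s , s≢ε
         ; (there a∈) → let (a∈lf , a≢ε) = ∈-filter⁻ (λ a → ¬? (a ≟ ε)) {xs = leftFactors s ss} a∈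
                        in let (sa , a∣s) = to (∈-leftFactors ss) a∈lf in sa , a∣s , a≢ε })
      (λ (sa , a∣s , a≢ε) → there (∈-filter⁺ (λ a → ¬? (a ≟ ε)) (from (∈-leftFactors ss) (sa , a∣s)) a≢ε))

  ∃-irreducible-‡ : ∀ {s} → S s → s ≢ ε → ∃ λ p → Irreducible p × p ‡ s
  ∃-irreducible-‡ {s} ss s≢ε =
    let (m , m∈ , m-min) = ∃-minimal _≟_ _‡?_ ‡-trans ‡-antisym s candidates
        (sm , m‡s , m≢ε) = to candidate⇔ m∈
    in m , ‡-minimal⇒irreducible sm m≢ε (λ sb b≢ε b‡m → m-min (from candidate⇔ (sb , ‡-trans b‡m m‡s , b≢ε)) b‡m) , m‡s
    where
    candidates = filter (λ b → ¬? (b ≟ ε)) (rightFactors s ss)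
    candidate⇔ : ∀ {b} → b ∈ s ∷ candidates ⇔ (S b × b ‡ s × b ≢ ε)
    candidate⇔ = mk⇔
      (λ { (here refl) → ss , ‡-refl s , s≢ε
         ; (there b∈) → let (b∈rf , b≢ε) = ∈-filter⁻ (λ b → ¬? (b ≟ ε)) {xs = rightFactors s ss} b∈
                        in let (sb , b‡s) = to (∈-rightFactors ss) b∈rf in sb , b‡s , b≢ε })
      (λ (sb , b‡s , b≢ε) → there (∈-filter⁺ (λ b → ¬? (b ≟ ε)) (from (∈-rightFactors ss) (sb , b‡s)) b≢ε))

  𝓕⇒S : ∀ {z x} → 𝓕 z x → S x
  𝓕⇒S (p , (_ , p‡z) , refl) = to ‡⇔S p‡z

  𝓕⇒∣ : ∀ {z x} → 𝓕 z x → x ∣ z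
  𝓕⇒∣ {z} (p , ((sp , _) , _) , refl) = p , sp , sym (//-rightDividesˡ p z)

  z∤𝓕 : ∀ {z x} → 𝓕 z x → ¬ z ∣ x
  z∤𝓕 {z} (p , (irr@(sp , _) , _) , refl) (t , st , zp⁻¹≡zt) =
    irreducible⇒≢ε irr (axI sp (subst S (sym (∙-cancelˡ z _ t zp⁻¹≡zt)) st))

  proper-divisor⇒∣𝓕 : ∀ {z d} → S d → d ∣ z → d ≢ z → ∃ λ x → 𝓕 z x × d ∣ x
  proper-divisor⇒∣𝓕 {z} {d} sd (s , ss , z≡ds) d≢z with s ≟ ε
  ... | yes refl = contradiction (sym (trans z≡ds (identityʳ d))) d≢z
  ... | no s≢ε =
    let (p , irr , t , st , s≡tp) = ∃-irreducible-‡ ss s≢ε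
        z≡dt∙p = trans z≡ds (trans (cong (d ∙_) s≡tp) (sym (assoc d t p)))
    in z ∙ p ⁻¹ , (p , (irr , d ∙ t , S-∙ sd st , z≡dt∙p) , refl) , t , st , sym (x≈z//y (d ∙ t) p z (sym z≡dt∙p))

  𝓕‡⇒S : ∀ {z x} → 𝓕‡ z x → S x
  𝓕‡⇒S (p , (_ , p∣z) , refl) = to ∣⇔S p∣z

  𝓕‡⇒‡ : ∀ {z x} → 𝓕‡ z x → x ‡ z
  𝓕‡⇒‡ {z} (p , ((sp , _) , _) , refl) = p , sp , sym (\\-leftDividesˡ p z)

  z‡̸𝓕‡ : ∀ {z x} → 𝓕‡ z x → ¬ z ‡ x
  z‡̸𝓕‡ {z} (p , (irr@(sp , _) , _) , refl) (t , st , p⁻¹z≡tz) =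
    irreducible⇒≢ε irr (axI sp (subst S (sym (∙-cancelʳ z _ t p⁻¹z≡tz)) st))

  proper-codivisor⇒‡𝓕‡ : ∀ {z d} → S d → d ‡ z → d ≢ z → ∃ λ x → 𝓕‡ z x × d ‡ x
  proper-codivisor⇒‡𝓕‡ {z} {d} sd (s , ss , z≡sd) d≢z with s ≟ ε
  ... | yes refl = contradiction (sym (trans z≡sd (identityˡ d))) d≢z
  ... | no s≢ε =
    let (p , irr , t , st , s≡pt) = ∃-irreducible-∣ ss s≢ε
        z≡p∙td = trans z≡sd (trans (cong (_∙ d) s≡pt) (assoc p t d))
    in p ⁻¹ ∙ z , (p , (irr , t ∙ d , S-∙ st sd , z≡p∙td) , refl) , t , st , sym (y≈x\\z p (t ∙ d) z (sym z≡p∙td))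

  IsDelta⇒≡⟦≟ε⟧ : ∀ {z s} → IsDelta z s → s ≡ ⟦ z ≟ ε ⟧
  IsDelta⇒≡⟦≟ε⟧ {z} (at-ε , off-ε) = case z ≟ ε of λ where
    (yes z≡ε) → trans (at-ε z≡ε) (sym (⟦⟧-yes z≡ε (z ≟ ε)))
    (no z≢ε)  → trans (off-ε z≢ε) (sym (⟦⟧-no z≢ε (z ≟ ε)))

  ‡⇔∣-quotients : ∀ z {d u} → d ‡ u ⇔ (z ∙ u ⁻¹) ∣ (z ∙ d ⁻¹)
  ‡⇔∣-quotients z {d} {u} = ⇔.trans ‡⇔S (⇔.trans (mk⇔ (subst S quotient) (subst S (sym quotient))) (⇔.sym ∣⇔S))
    where
    open ≡-Reasoning
    quotient : u ∙ d ⁻¹ ≡ (z ∙ u ⁻¹) ⁻¹ ∙ (z ∙ d ⁻¹)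
    quotient = sym (begin
      (z ∙ u ⁻¹) ⁻¹ ∙ (z ∙ d ⁻¹)      ≡⟨ cong (_∙ (z ∙ d ⁻¹)) (⁻¹-anti-homo-∙ z (u ⁻¹)) ⟩
      (u ⁻¹ ⁻¹ ∙ z ⁻¹) ∙ (z ∙ d ⁻¹)   ≡⟨ cong (λ v → (v ∙ z ⁻¹) ∙ (z ∙ d ⁻¹)) (⁻¹-involutive u) ⟩
      (u ∙ z ⁻¹) ∙ (z ∙ d ⁻¹)         ≡⟨ assoc u (z ⁻¹) (z ∙ d ⁻¹) ⟩
      u ∙ (z ⁻¹ ∙ (z ∙ d ⁻¹))         ≡⟨ cong (u ∙_) (\\-leftDividesʳ z (d ⁻¹)) ⟩
      u ∙ d ⁻¹                        ∎)

  ‡⁻¹∙⇔∣ : ∀ {d l z} → d ‡ (l ⁻¹ ∙ z) ⇔ l ∣ (z ∙ d ⁻¹)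
  ‡⁻¹∙⇔∣ {d} {l} {z} = ⇔.trans ‡⇔S (⇔.trans (mk⇔ (subst S (assoc (l ⁻¹) z (d ⁻¹))) (subst S (sym (assoc (l ⁻¹) z (d ⁻¹))))) (⇔.sym ∣⇔S))

  module _ {z w : G} {Q : G → Set} {f : G → ℤ} {s : ℤ} where

    -- (a , b) ↦ (a , b z⁻¹ w) sends the factorizations of z with left factor in Q onto those of w.
    Σ-leftFactors : (∀ {a} → S a → (a ∣ z × Q a) ⇔ a ∣ w) → HasSum (Factorization w) (f ∘ proj₁) s →
      HasSum (λ x → Factorization z x × Q (proj₁ x)) (f ∘ proj₁) s
    Σ-leftFactors cond Σw xs xs-enum =
      trans (sym (Σ-map xs shift (f ∘ proj₁))) (Σw (map shift xs) (map-enumerates shift-injective image xs-enum))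
      where
      k = z ⁻¹ ∙ w
      shift : G × G → G × G
      shift (a , b) = a , b ∙ k
      shift-injective : ∀ {x y} → shift x ≡ shift y → x ≡ y
      shift-injective {a , b} {a′ , b′} eq = ×-≡,≡→≡ (cong proj₁ eq , ∙-cancelʳ k b b′ (cong proj₂ eq))
      shifted : ∀ {a b} → a ∙ b ≡ z → a ∙ (b ∙ k) ≡ w
      shifted {a} {b} ab≡z = trans (sym (assoc a b k)) (trans (cong (_∙ k) ab≡z) (\\-leftDividesˡ z w))
      image : ∀ y → Factorization w y ⇔ ∃ λ x → (Factorization z x × Q (proj₁ x)) × y ≡ shift x
      image (a , b′) = mk⇔
        (λ (sa , sb′ , ab′≡w) → let ((s , ss , z≡as) , qa) = from (cond sa) (b′ , sb′ , sym ab′≡w) in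
          (a , s) , ((sa , ss , sym z≡as) , qa) ,
          cong (a ,_) (∙-cancelˡ a b′ (s ∙ k) (trans ab′≡w (sym (shifted (sym z≡as))))))
        (λ { ((a , b) , ((sa , sb , ab≡z) , qa) , refl) →
          let (t , st , w≡at) = to (cond sa) ((b , sb , sym ab≡z) , qa) in
          sa , subst S (∙-cancelˡ a t (b ∙ k) (trans (sym w≡at) (sym (shifted ab≡z)))) st , shifted ab≡z })

    -- (a , b) ↦ (w z⁻¹ a , b) sends the factorizations of z with right factor in Q onto those of w.
    Σ-rightFactors : (∀ {b} → S b → (b ‡ z × Q b) ⇔ b ‡ w) → HasSum (Factorization w) (f ∘ proj₂) s →
      HasSum (λ x → Factorization z x × Q (proj₂ x)) (f ∘ proj₂) s
    Σ-rightFactors cond Σw xs xs-enum =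
      trans (sym (Σ-map xs shift (f ∘ proj₂))) (Σw (map shift xs) (map-enumerates shift-injective image xs-enum))
      where
      k = w ∙ z ⁻¹
      shift : G × G → G × G
      shift (a , b) = k ∙ a , b
      shift-injective : ∀ {x y} → shift x ≡ shift y → x ≡ y
      shift-injective {a , b} {a′ , b′} eq = ×-≡,≡→≡ (∙-cancelˡ k a a′ (cong proj₁ eq) , cong proj₂ eq)
      shifted : ∀ {a b} → a ∙ b ≡ z → (k ∙ a) ∙ b ≡ w
      shifted {a} {b} ab≡z = trans (assoc k a b) (trans (cong (k ∙_) ab≡z) (//-rightDividesˡ z w))
      image : ∀ y → Factorization w y ⇔ ∃ λ x → (Factorization z x × Q (proj₂ x)) × y ≡ shift x
      image (a′ , b) = mk⇔
        (λ (sa′ , sb , a′b≡w) → let ((s , ss , z≡sb) , qb) = from (cond sb) (a′ , sa′ , sym a′b≡w) in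
          (s , b) , ((ss , sb , sym z≡sb) , qb) ,
          cong (_, b) (∙-cancelʳ b a′ (k ∙ s) (trans a′b≡w (sym (shifted (sym z≡sb))))))
        (λ { ((a , b) , ((sa , sb , ab≡z) , qb) , refl) →
          let (t , st , w≡tb) = to (cond sb) ((a , sa , sym ab≡z) , qb) in
          subst S (∙-cancelʳ b t (k ∙ a) (trans (sym w≡tb) (sym (shifted ab≡z)))) st , sb , shifted ab≡z })

  module Möbius {μ : G → ℤ} (μ-mobius : IsMobius μ) where

    Σμˡ : ∀ {z} → S z → HasSum (Factorization z) (μ ∘ proj₁) ⟦ z ≟ ε ⟧
    Σμˡ sz xs xs-enum = IsDelta⇒≡⟦≟ε⟧ (proj₁ (μ-mobius _ sz xs xs-enum))

    Σμʳ : ∀ {z} → S z → HasSum (Factorization z) (μ ∘ proj₂) ⟦ z ≟ ε ⟧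
    Σμʳ sz xs xs-enum = IsDelta⇒≡⟦≟ε⟧ (proj₂ (μ-mobius _ sz xs xs-enum))

    μ-ε : μ ε ≡ 1ℤ
    μ-ε = begin
        μ ε
      ≡⟨ sym (hasSum-singleton (ε , ε) (μ ∘ proj₁) _ (enumerates-⇔ ε-factorization⇔ ε-enum)) ⟩
        Σ[ factorizations ε S-ε ] (μ ∘ proj₁)
      ≡⟨ Σμˡ S-ε _ ε-enum ⟩
        ⟦ ε ≟ ε ⟧
      ≡⟨ ⟦⟧-yes refl (ε ≟ ε) ⟩
        1ℤ ∎
      where
      open ≡-Reasoning
      ε-enum = factorizations-enumerates ε S-ε
      ε-factorization⇔ : ∀ x → Factorization ε x ⇔ x ≡ (ε , ε)
      ε-factorization⇔ x = mk⇔ ε-factorization (λ { refl → S-ε , S-ε , identityˡ ε })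

    module _ {z : G} (sz : S z) (z≢ε : z ≢ ε) where

      Σμˡ-nonunit : ∀ {Q : G × G → Set} → (∀ x → Q x) → HasSum (λ x → Factorization z x × Q x) (μ ∘ proj₁) 0ℤ
      Σμˡ-nonunit q = hasSum-⇔ (λ x → mk⇔ proj₁ (_, q x)) (subst (HasSum _ _) (⟦⟧-no z≢ε (z ≟ ε)) (Σμˡ sz))

      Σμʳ-nonunit : ∀ {Q : G × G → Set} → (∀ x → Q x) → HasSum (λ x → Factorization z x × Q x) (μ ∘ proj₂) 0ℤ
      Σμʳ-nonunit q = hasSum-⇔ (λ x → mk⇔ proj₁ (_, q x)) (subst (HasSum _ _) (⟦⟧-no z≢ε (z ≟ ε)) (Σμʳ sz))

      module Formula₁ {L : List G} (L-enum : Enumerates (𝓕 z) L) where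

        c : Fin (length L) → G
        c = lookup L

        trivial-factorization : ∀ x → (Factorization z x × (∀ i → ¬ proj₁ x ∣ c i)) ⇔ x ≡ (z , ε)
        trivial-factorization (d , e) = mk⇔
          (λ ((sd , se , de≡z) , d∤c) → case d ≟ z of λ where
            (yes refl) → cong (z ,_) (∙-cancelˡ z e ε (trans de≡z (sym (identityʳ z))))
            (no d≢z)   → let (x , x∈𝓕 , d∣x) = proper-divisor⇒∣𝓕 sd (e , se , sym de≡z) d≢z
                             (i , ci≡x) = ∃-lookup L-enum x∈𝓕
                         in contradiction (subst (d ∣_) (sym ci≡x) d∣x) (d∤c i))
          (λ { refl → (sz , S-ε , identityʳ z) , λ i → z∤𝓕 (lookup-∈ L-enum i) })

        gcd-of : ∀ {F} → Nonempty F → ∃ (IsGcd (Elem L F))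
        gcd-of {F} (i , i∈F) = map₂ (IsGcd-⇔ (λ _ → ∈-select))
          (∃-gcd (select c F) (from ∈-select (i , i∈F , refl))
                 (λ v v∈ → let (j , _ , cj≡v) = to ∈-select v∈ in subst S cj≡v (𝓕⇒S (lookup-∈ L-enum j))))

        coprime⇔ : ∀ {F g} → Nonempty F → IsGcd (Elem L F) g → g ≡ ε ⇔ (Nonempty F × IsGcd (Elem L F) ε)
        coprime⇔ ne g-gcd = mk⇔ (λ g≡ε → ne , from (IsLcm⇔≡ g-gcd) g≡ε) (to (IsLcm⇔≡ g-gcd) ∘ proj₂)

        coprime? : ∀ F → Dec (Nonempty F × IsGcd (Elem L F) ε)
        coprime? F with nonempty? F
        ... | no ¬ne = no (¬ne ∘ proj₁)
        ... | yes ne = let (g , g-gcd) = gcd-of ne in Dec.map (coprime⇔ ne g-gcd) (g ≟ ε)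

        common-divisors⇔ : ∀ {F g a} → Nonempty F → IsGcd (Elem L F) g → S a →
          (a ∣ z × AllIn (λ i → a ∣ c i) F) ⇔ a ∣ g
        common-divisors⇔ (i₀ , i₀∈F) g-gcd sa = mk⇔
          (λ (_ , a∣cF) → from (IsGcd⇒∣⇔ g-gcd sa) (λ { _ (i , i∈F , refl) → a∣cF i i∈F }))
          (λ a∣g → let a∣cF = to (IsGcd⇒∣⇔ g-gcd sa) a∣g in
            ∣-trans (a∣cF _ (i₀ , i₀∈F , refl)) (𝓕⇒∣ (lookup-∈ L-enum i₀)) , λ i i∈F → a∣cF _ (i , i∈F , refl))

        -- The divisors of z dividing every c i (i ∈ F) are the divisors of gcd F.
        Σ-common-divisors : ∀ F → HasSum (λ x → Factorization z x × AllIn (λ i → proj₁ x ∣ c i) F)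
                                         (μ ∘ proj₁) ⟦ coprime? F ⟧
        Σ-common-divisors F = case nonempty? F of λ where
          (no ¬ne) → subst (HasSum _ _) (sym (⟦⟧-no (¬ne ∘ proj₁) (coprime? F)))
                       (Σμˡ-nonunit (λ x i i∈F → contradiction (i , i∈F) ¬ne))
          (yes ne) → let (g , g-gcd) = gcd-of ne in
            subst (HasSum _ _) (⟦⟧-cong (coprime⇔ ne g-gcd) (g ≟ ε) (coprime? F))
              (Σ-leftFactors (common-divisors⇔ ne g-gcd) (Σμˡ (proj₁ g-gcd)))

        formula : SignedSubsetSum (length L) (λ F → Nonempty F × IsGcd (Elem L F) ε) (μ z)
        formula = sieve (λ x i → proj₁ x ∣ c i) (λ x i → proj₁ x ∣? c i) (factorizations-enumerates z sz) (μ ∘ proj₁)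
          (hasSum-⇔ trivial-factorization (hasSum-singleton (z , ε) (μ ∘ proj₁))) coprime? Σ-common-divisors

      module Formula₂ {L : List G} (L-enum : Enumerates (𝓕‡ z) L) where

        e : Fin (length L) → G
        e = lookup L

        trivial-factorization : ∀ x → (Factorization z x × (∀ i → ¬ proj₂ x ‡ e i)) ⇔ x ≡ (ε , z)
        trivial-factorization (a , d) = mk⇔
          (λ ((sa , sd , ad≡z) , d‡̸e) → case d ≟ z of λ where
            (yes refl) → cong (_, z) (∙-cancelʳ z a ε (trans ad≡z (sym (identityˡ z))))
            (no d≢z)   → let (x , x∈𝓕‡ , d‡x) = proper-codivisor⇒‡𝓕‡ sd (a , sa , sym ad≡z) d≢z
                             (i , ei≡x) = ∃-lookup L-enum x∈𝓕‡
                         in contradiction (subst (d ‡_) (sym ei≡x) d‡x) (d‡̸e i))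
          (λ { refl → (S-ε , sz , identityˡ z) , λ i → z‡̸𝓕‡ (lookup-∈ L-enum i) })

        Quotients : Subset (length L) → G → Set
        Quotients F v = ∃ λ u → Elem L F u × v ≡ z ∙ u ⁻¹

        lcm-of : ∀ {F} → Nonempty F → ∃ (IsLcm (Quotients F))
        lcm-of {F} (i , i∈F) = lcmList quotients , IsLcm-⇔ ∈quotients⇔
          (lcmList-isLcm quotients (from (∈quotients⇔ _) (e i , (i , i∈F , refl) , refl)) quotients⊆S)
          where
          quotients = map (λ u → z ∙ u ⁻¹) (select e F)
          ∈quotients⇔ : ∀ v → v ∈ quotients ⇔ Quotients F v
          ∈quotients⇔ v = ⇔.trans ∈-map⇔ (mk⇔ (map₂ (map₁ (to ∈-select))) (map₂ (map₁ (from ∈-select))))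
          quotients⊆S : ∀ v → v ∈ quotients → S v
          quotients⊆S v v∈ with to (∈quotients⇔ v) v∈
          ... | _ , (j , _ , refl) , refl = to ‡⇔S (𝓕‡⇒‡ (lookup-∈ L-enum j))

        coprime⇔ : ∀ {F l} → Nonempty F → IsLcm (Quotients F) l → l ⁻¹ ∙ z ≡ ε ⇔ (Nonempty F × IsGcd‡ z (Elem L F) ε)
        coprime⇔ ne l-lcm = mk⇔
          (λ l⁻¹z≡ε → ne , _ , l-lcm , sym l⁻¹z≡ε)
          (λ (_ , l′ , l′-lcm , ε≡l′⁻¹z) → trans (cong (λ v → v ⁻¹ ∙ z) (to (IsLcm⇔≡ l-lcm) l′-lcm)) (sym ε≡l′⁻¹z))

        coprime? : ∀ F → Dec (Nonempty F × IsGcd‡ z (Elem L F) ε)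
        coprime? F with nonempty? F
        ... | no ¬ne = no (¬ne ∘ proj₁)
        ... | yes ne = let (l , l-lcm) = lcm-of ne in Dec.map (coprime⇔ ne l-lcm) (l ⁻¹ ∙ z ≟ ε)

        common-codivisors⇔ : ∀ {F l d} → IsLcm (Quotients F) l → S d →
          (d ‡ z × AllIn (λ i → d ‡ e i) F) ⇔ d ‡ (l ⁻¹ ∙ z)
        common-codivisors⇔ l-lcm@(sl , _) sd = ⇔.trans (mk⇔
          (λ (_ , d‡eF) → IsLcm⇒least l-lcm λ { _ (_ , (i , i∈F , refl) , refl) → to (‡⇔∣-quotients z) (d‡eF i i∈F) })
          (λ l∣zd⁻¹ → from ‡⇔S (∣⇒S sl l∣zd⁻¹) ,
             λ i i∈F → from (‡⇔∣-quotients z) (∣-trans (IsLcm⇒∣ l-lcm (e i , (i , i∈F , refl) , refl)) l∣zd⁻¹)))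
          (⇔.sym ‡⁻¹∙⇔∣)

        -- With l = lcm {z u⁻¹ : u ∈ F}, the co-divisors of z co-dividing every e i (i ∈ F) are those of l⁻¹ z.
        Σ-common-codivisors : ∀ F → HasSum (λ x → Factorization z x × AllIn (λ i → proj₂ x ‡ e i) F)
                                           (μ ∘ proj₂) ⟦ coprime? F ⟧
        Σ-common-codivisors F = case nonempty? F of λ where
          (no ¬ne) → subst (HasSum _ _) (sym (⟦⟧-no (¬ne ∘ proj₁) (coprime? F)))
                       (Σμʳ-nonunit (λ x i i∈F → contradiction (i , i∈F) ¬ne))
          (yes ne) → let (l , l-lcm) = lcm-of ne
                         ε‡z∧eF = ε‡ sz , λ i _ → ε‡ (𝓕‡⇒S (lookup-∈ L-enum i))
                     in subst (HasSum _ _) (⟦⟧-cong (coprime⇔ ne l-lcm) (l ⁻¹ ∙ z ≟ ε) (coprime? F))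
                          (Σ-rightFactors (common-codivisors⇔ l-lcm)
                            (Σμʳ (‡⇒S S-ε (to (common-codivisors⇔ l-lcm S-ε) ε‡z∧eF))))

        formula : SignedSubsetSum (length L) (λ F → Nonempty F × IsGcd‡ z (Elem L F) ε) (μ z)
        formula = sieve (λ x i → proj₂ x ‡ e i) (λ x i → proj₂ x ‡? e i) (factorizations-enumerates z sz) (μ ∘ proj₂)
          (hasSum-⇔ trivial-factorization (hasSum-singleton (ε , z) (μ ∘ proj₂))) coprime? Σ-common-codivisors

mainTheorem4 : (M : IntegralMonoid) (μ : IntegralMonoid.G M → ℤ) → IM.IsMobius M μ →
    (μ (IntegralMonoid.ε M) ≡ 1ℤ)
    × (∀ z → IntegralMonoid.S M z → z ≢ IntegralMonoid.ε M →
        (∀ (L : List (IntegralMonoid.G M)) → Enumerates (IM.𝓕 M z) L →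
           SignedSubsetSum (length L)
             (λ F → Nonempty F × IM.IsGcd M (IM.Elem M L F) (IntegralMonoid.ε M)) (μ z))
        × (∀ (L : List (IntegralMonoid.G M)) → Enumerates (IM.𝓕‡ M z) L →
           SignedSubsetSum (length L)
             (λ F → Nonempty F × IM.IsGcd‡ M z (IM.Elem M L F) (IntegralMonoid.ε M)) (μ z)))
mainTheorem4 M μ μ-mobius =
  μ-ε , λ z sz z≢ε → (λ _ → Formula₁.formula sz z≢ε) , (λ _ → Formula₂.formula sz z≢ε)
  where
  open Theory M
  open Möbius μ-mobius
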